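{- Let $q$ be a prime power and $\nu\ge1$. For $T\in Sp_{2\nu}(\mathbb{F}_q,K_{2\nu})$ define $\sigma_T$ on the vertex set of $Spi(2\nu,q)$ by $\sigma_T(A)=AT$ (the image of the subspace $A$ under right multiplication by $T$). Then (1) $\sigma_T$ is an automorphism of $Spi(2\nu,q)$; (2) for any $T_1,T_2\in Sp_{2\nu}(\mathbb{F}_q,K_{2\nu})$, $\sigma_{T_1}=\sigma_{T_2}$ if and only if $T_1=\pm T_2$.
   Context: $\mathbb{F}_q^{(2\nu)}$ is the space of row vectors of length $2\nu$ over $\mathbb{F}_q$ and $K_{2\nu}=\begin{pmatrix}0 & I^{(\nu)}\\ -I^{(\nu)} & 0\end{pmatrix}$. $Sp_{2\nu}(\mathbb{F}_q,K_{2\nu})$ is the group of $2\nu\times2\nu$ matrices $T$ over $\mathbb{F}_q$ with $TK_{2\nu}{}^tT=K_{2\nu}$. A subspace of dimension $m$ is identified with any $m\times 2\nu$ matrix whose rows form a basis of it. The graph $Spi(2\nu,q)$ has as vertex set all subspaces of $\mathbb{F}_q^{(2\nu)}$ other than $0$ and $\mathbb{F}_q^{(2\nu)}$, with $A,B$ (not necessarily distinct) adjacent iff $AK_{2\nu}{}^tB=0$. An automorphism is a bijection of the vertex set such that $A,B$ are adjacent iff their images are adjacent. -}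

module Defs where

open import Level using (Level; _⊔_) renaming (suc to lsuc)
open import Algebra.Bundles using (CommutativeRing)
open import Data.Nat using (ℕ; zero; suc; _^_; _≤_; _<_) renaming (_+_ to _+ℕ_)
open import Data.Nat.Primality using (Prime)
open import Data.Fin using (Fin; splitAt; _≟_)
open import Data.Fin.Base using () renaming (zero to fz; suc to fs)
open import Data.Sum using (_⊎_; inj₁; inj₂)
open import Data.Product using (Σ; ∃; _×_; _,_)
open import Relation.Nullary using (¬_; yes; no)
open import Relation.Binary.PropositionalEquality using (_≡_)

IsPrimePower : ℕ → Set
IsPrimePower q = ∃ λ p → ∃ λ k → Prime p × 1 ≤ k × q ≡ p ^ k

record Field (c ℓ : Level) : Set (lsuc (c ⊔ ℓ)) where
  field
    commutativeRing : CommutativeRing c ℓ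
  open CommutativeRing commutativeRing public
  field
    1≉0     : ¬ (1# ≈ 0#)
    inverse : ∀ x → ¬ (x ≈ 0#) → ∃ λ y → (x * y) ≈ 1#

HasSize : ∀ {c ℓ} → Field c ℓ → ℕ → Set (c ⊔ ℓ)
HasSize F q = Σ (Fin q → Carrier) λ e →
    (∀ x → ∃ λ i → e i ≈ x) × (∀ i j → e i ≈ e j → i ≡ j)
  where open Field F

module Spi {c ℓ} (F : Field c ℓ) (ν : ℕ) where
  open Field F

  n : ℕ
  n = ν +ℕ ν

  Mat : ℕ → ℕ → Set c
  Mat a b = Fin a → Fin b → Carrier

  Σ' : ∀ {k} → (Fin k → Carrier) → Carrier
  Σ' {zero}  f = 0#
  Σ' {suc k} f = f fz + Σ' (λ i → f (fs i))

  _⊛_ : ∀ {a b d} → Mat a b → Mat b d → Mat a d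
  (A ⊛ B) i j = Σ' (λ k → A i k * B k j)

  transpose : ∀ {a b} → Mat a b → Mat b a
  transpose A i j = A j i

  negM : ∀ {a b} → Mat a b → Mat a b
  negM A i j = - (A i j)

  _≈M_ : ∀ {a b} → Mat a b → Mat a b → Set ℓ
  A ≈M B = ∀ i j → A i j ≈ B i j

  δ : Fin ν → Fin ν → Carrier
  δ i j with i ≟ j
  ... | yes _ = 1#
  ... | no _  = 0#

  -- K_{2ν} = [[0, I],[-I, 0]]
  K : Mat n n
  K i j with splitAt ν i | splitAt ν j
  ... | inj₁ i' | inj₂ j' = δ i' j'
  ... | inj₂ i' | inj₁ j' = - (δ i' j')
  ... | _       | _       = 0#

  IsSymplectic : Mat n n → Set ℓ
  IsSymplectic T = ((T ⊛ K) ⊛ transpose T) ≈M K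

  _·_ : ∀ {a b} → (Fin a → Carrier) → Mat a b → Fin b → Carrier
  (v · A) j = Σ' (λ k → v k * A k j)

  LinIndep : ∀ {a b} → Mat a b → Set (c ⊔ ℓ)
  LinIndep A = ∀ v → (∀ j → (v · A) j ≈ 0#) → ∀ i → v i ≈ 0#

  InRowSpace : ∀ {a} → Mat a n → (Fin n → Carrier) → Set (c ⊔ ℓ)
  InRowSpace A w = ∃ λ v → ∀ j → (v · A) j ≈ w j

  -- raw representatives: an m × 2ν matrix (m rows spanning the subspace)
  Raw : Set c
  Raw = Σ ℕ λ m → Mat m n

  -- vertex: m-dim subspace with 0 < m < 2ν, given by a matrix with independent rows
  IsVertex : Raw → Set (c ⊔ ℓ)
  IsVertex (m , A) = 1 ≤ m × m < n × LinIndep A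

  -- two representatives denote the same subspace (equal row spaces)
  _≋_ : Raw → Raw → Set (c ⊔ ℓ)
  (m , A) ≋ (m' , B) = (∀ i → InRowSpace B (A i)) × (∀ i → InRowSpace A (B i))

  Adj : Raw → Raw → Set ℓ
  Adj (m , A) (m' , B) = ∀ i j → ((A ⊛ K) ⊛ transpose B) i j ≈ 0#

  σ : Mat n n → Raw → Raw
  σ T (m , A) = (m , A ⊛ T)

  -- f (acting on representatives) induces an automorphism of Spi(2ν,q)
  record IsAutomorphism (f : Raw → Raw) : Set (c ⊔ ℓ) where
    field
      closed     : ∀ A → IsVertex A → IsVertex (f A)
      wellDef    : ∀ A B → IsVertex A → IsVertex B → A ≋ B → f A ≋ f B
      injective  : ∀ A B → IsVertex A → IsVertex B → f A ≋ f B → A ≋ B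
      surjective : ∀ B → IsVertex B → ∃ λ A → IsVertex A × (f A ≋ B)
      adjTo      : ∀ A B → IsVertex A → IsVertex B → Adj A B → Adj (f A) (f B)
      adjFrom    : ∀ A B → IsVertex A → IsVertex B → Adj (f A) (f B) → Adj A B

module Submission where

-- A symplectic T has the explicit right inverse −K Tᵗ K, because K² = −I. Over a finite field
-- v ↦ vT is then an injective, hence surjective, self-map of the finite set of row vectors, so
-- this right inverse is two-sided: σ_T keeps rows independent and is a bijection on subspaces,
-- and it preserves adjacency because (AT) K (BT)ᵗ = A (T K Tᵗ) Bᵗ = A K Bᵗ.
-- Conversely, if σ_{T₁} = σ_{T₂} then every line ⟨v⟩ gives vT₁ = x_v · vT₂. Comparing the lines
-- spanned by eᵢ, e₀ and eᵢ + e₀ and cancelling T₂ shows that all the x_v agree, so T₁ = x T₂;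
-- then K = T₁ K T₁ᵗ = x² K forces x² = 1, i.e. x = ±1 (equality is decidable in a finite field).

open import Level using (_⊔_)
import Data.Nat as ℕ
open ℕ using (ℕ; zero; suc; _^_; _≤_; _<_)
open import Data.Nat.Properties using (n<1+n; ≤-refl; +-mono-≤)
open import Data.Fin as Fin using (Fin; splitAt; join; _↑ˡ_; _↑ʳ_; punchOut; combine; finToFun; funToFin)
open import Data.Fin.Properties
  using (splitAt-↑ˡ; splitAt-↑ʳ; join-splitAt; pigeonhole; punchOut-injective; <⇒≢; any?;
         finToFun-funToFin; funToFin-finToFin)
open import Data.Product using (∃; _×_; _,_; proj₁; proj₂)
open import Data.Sum using (_⊎_; inj₁; inj₂; [_,_])
open import Relation.Nullary using (¬_; yes; no; contradiction)
open import Relation.Binary.Bundles using (Setoid)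
open import Relation.Binary.Definitions using (Decidable)
import Relation.Binary.PropositionalEquality as ≡
open ≡ using (_≡_; _≢_; _≗_)
open import Function using (_∘_)
open import Defs
import Relation.Binary.Reasoning.Setoid as SetoidReasoning
import Data.Vec.Functional.Relation.Binary.Equality.Setoid as VecEquality

injective⇒surjective : ∀ {N} (f : Fin N → Fin N) → (∀ {i j} → f i ≡ f j → i ≡ j) →
                       ∀ j → ∃ λ i → f i ≡ j
injective⇒surjective {zero}  f f-inj ()
injective⇒surjective {suc N} f f-inj j with any? (λ i → f i Fin.≟ j)
... | yes hit = hit
... | no miss
  with i , k , i<k , same ← pigeonhole (n<1+n N) (λ i → punchOut {i = j} (λ j≡fi → miss (i , ≡.sym j≡fi)))
  = contradiction (f-inj (punchOut-injective {i = j} _ _ same)) (<⇒≢ i<k)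

splitAt-elim : ∀ {p} m {n} (P : Fin (m ℕ.+ n) → Set p) →
               (∀ a → P (a ↑ˡ n)) → (∀ b → P (m ↑ʳ b)) → ∀ i → P i
splitAt-elim m {n} P left right i =
  ≡.subst P (join-splitAt m n i) ([_,_] {C = λ s → P (join m n s)} left right (splitAt m i))

funToFin-cong : ∀ {m n} {f g : Fin m → Fin n} → f ≗ g → funToFin f ≡ funToFin g
funToFin-cong {zero}  _   = ≡.refl
funToFin-cong {suc m} f≗g = ≡.cong₂ combine (f≗g Fin.zero) (funToFin-cong (f≗g ∘ Fin.suc))

record Enumeration {a ℓ} (S : Setoid a ℓ) (N : ℕ) : Set (a ⊔ ℓ) where
  open Setoid S
  field
    enum       : Fin N → Carrier
    enum-surj  : ∀ x → ∃ λ i → enum i ≈ x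
    enum-inj   : ∀ i j → enum i ≈ enum j → i ≡ j

module _ {a ℓ} {S : Setoid a ℓ} {N : ℕ} (enumeration : Enumeration S N) where
  open Setoid S
  open Enumeration enumeration
  open VecEquality S using (_≋_; ≋-setoid)
  open SetoidReasoning S

  private
    index : Carrier → Fin N
    index x = proj₁ (enum-surj x)

    enum-index : ∀ x → enum (index x) ≈ x
    enum-index x = proj₂ (enum-surj x)

  enumerated⇒decidable : Decidable _≈_
  enumerated⇒decidable x y with index x Fin.≟ index y
  ... | yes same = yes (begin
    x              ≈⟨ enum-index x ⟨
    enum (index x) ≡⟨ ≡.cong enum same ⟩
    enum (index y) ≈⟨ enum-index y ⟩
    y              ∎)
  ... | no differ = no λ x≈y → differ (enum-inj _ _ (begin
    enum (index x) ≈⟨ enum-index x ⟩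
    x              ≈⟨ x≈y ⟩
    y              ≈⟨ enum-index y ⟨
    enum (index y) ∎))

  enumerated-injective⇒surjective : (f : Carrier → Carrier) → (∀ {x y} → f x ≈ f y → x ≈ y) →
                                    ∀ y → ∃ λ x → f x ≈ y
  enumerated-injective⇒surjective f f-inj y = preimage (injective⇒surjective g g-inj (index y))
    where
      g : Fin N → Fin N
      g i = index (f (enum i))

      enum-g : ∀ i → enum (g i) ≈ f (enum i)
      enum-g i = enum-index (f (enum i))

      g-inj : ∀ {i j} → g i ≡ g j → i ≡ j
      g-inj {i} {j} same = enum-inj i j (f-inj (begin
        f (enum i) ≈⟨ enum-g i ⟨
        enum (g i) ≡⟨ ≡.cong enum same ⟩
        enum (g j) ≈⟨ enum-g j ⟩
        f (enum j) ∎))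

      preimage : (∃ λ i → g i ≡ index y) → ∃ λ x → f x ≈ y
      preimage (i , gi≡) = enum i , (begin
        f (enum i)     ≈⟨ enum-g i ⟨
        enum (g i)     ≡⟨ ≡.cong enum gi≡ ⟩
        enum (index y) ≈⟨ enum-index y ⟩
        y              ∎)

  vectorEnumeration : ∀ k → Enumeration (≋-setoid k) (N ^ k)
  vectorEnumeration k = record { enum = λ x → enum ∘ finToFun x ; enum-surj = surj ; enum-inj = inj }
    where
      surj : ∀ v → ∃ λ x → enum ∘ finToFun x ≋ v
      surj v = funToFin (index ∘ v) , λ j → begin
        enum (finToFun (funToFin (index ∘ v)) j) ≡⟨ ≡.cong enum (finToFun-funToFin (index ∘ v) j) ⟩
        enum (index (v j))                       ≈⟨ enum-index (v j) ⟩
        v j                                      ∎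
      inj : ∀ x y → enum ∘ finToFun x ≋ enum ∘ finToFun y → x ≡ y
      inj x y same = ≡.trans (≡.sym (funToFin-finToFin {k} {N} x))
        (≡.trans (funToFin-cong (λ j → enum-inj _ _ (same j))) (funToFin-finToFin {k} {N} y))

module FieldProperties {c ℓ} (F : Field c ℓ) where
  open Field F
  open import Algebra.Properties.Ring ring using (-1*x≈-x)
  open import Algebra.Properties.Group +-group using (x∙y⁻¹≈ε⇒x≈y; inverseˡ-unique)
  open import Relation.Binary.Reasoning.Setoid setoid

  nonzero*≈0⇒≈0 : ∀ {x y} → ¬ (x ≈ 0#) → x * y ≈ 0# → y ≈ 0#
  nonzero*≈0⇒≈0 {x} {y} x≉0 xy≈0 with x⁻¹ , xx⁻¹≈1 ← inverse x x≉0 = begin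
    y              ≈⟨ *-identityˡ y ⟨
    1# * y         ≈⟨ *-congʳ (trans (*-comm x⁻¹ x) xx⁻¹≈1) ⟨
    x⁻¹ * x * y    ≈⟨ *-assoc x⁻¹ x y ⟩
    x⁻¹ * (x * y)  ≈⟨ *-congˡ xy≈0 ⟩
    x⁻¹ * 0#       ≈⟨ zeroʳ x⁻¹ ⟩
    0#             ∎

  ≈1⇒≉0 : ∀ {x} → x ≈ 1# → ¬ (x ≈ 0#)
  ≈1⇒≉0 x≈1 x≈0 = 1≉0 (trans (sym x≈1) x≈0)

  hasSize⇒enumeration : ∀ {q} → HasSize F q → Enumeration setoid q
  hasSize⇒enumeration (enum , surj , inj) = record { enum = enum ; enum-surj = surj ; enum-inj = inj }

  x*x≈1⇒x≈±1 : Decidable _≈_ → ∀ {x} → x * x ≈ 1# → x ≈ 1# ⊎ x ≈ - 1#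
  x*x≈1⇒x≈±1 _≟_ {x} xx≈1 with (x + - 1#) ≟ 0#
  ... | yes x-1≈0 = inj₁ (x∙y⁻¹≈ε⇒x≈y x 1# x-1≈0)
  ... | no  x-1≉0 = inj₂ (inverseˡ-unique x 1# (nonzero*≈0⇒≈0 x-1≉0 (begin
    (x + - 1#) * (x + 1#)              ≈⟨ distribʳ (x + 1#) x (- 1#) ⟩
    x * (x + 1#) + - 1# * (x + 1#)     ≈⟨ +-cong (distribˡ x x 1#) (-1*x≈-x (x + 1#)) ⟩
    (x * x + x * 1#) + - (x + 1#)      ≈⟨ +-congʳ (+-cong xx≈1 (*-identityʳ x)) ⟩
    (1# + x) + - (x + 1#)              ≈⟨ +-congʳ (+-comm 1# x) ⟩
    (x + 1#) + - (x + 1#)              ≈⟨ -‿inverseʳ (x + 1#) ⟩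
    0#                                 ∎)))

module MatrixAlgebra {c ℓ} (F : Field c ℓ) (ν : ℕ) where
  open Field F
  open Spi F ν
  open FieldProperties F using (≈1⇒≉0)
  open import Algebra.Properties.Ring ring using (-1*x≈-x; -‿distribˡ-*; -‿distribʳ-*)
  open import Algebra.Properties.CommutativeSemigroup *-commutativeSemigroup using (x∙yz≈y∙xz)
  open import Algebra.Properties.AbelianGroup +-abelianGroup using (⁻¹-involutive)
  open import Algebra.Properties.Group +-group using () renaming (ε⁻¹≈ε to -0#≈0#)
  open import Algebra.Properties.Semiring.Sum semiring
    using (sum; sum-cong-≋; sum-cong-≗; ∑-comm; ∑-distrib-+; *-distribˡ-sum; *-distribʳ-sum; sum-replicate-zero)
  open SetoidReasoning setoid

  Σ'≡sum : ∀ {k} (f : Fin k → Carrier) → Σ' f ≡ sum f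
  Σ'≡sum {zero}  f = ≡.refl
  Σ'≡sum {suc k} f = ≡.cong (f Fin.zero +_) (Σ'≡sum (f ∘ Fin.suc))

  Σ'-cong : ∀ {k} {f g : Fin k → Carrier} → (∀ i → f i ≈ g i) → Σ' f ≈ Σ' g
  Σ'-cong {f = f} {g} f≈g = begin
    Σ' f  ≡⟨ Σ'≡sum f ⟩
    sum f ≈⟨ sum-cong-≋ f≈g ⟩
    sum g ≡⟨ Σ'≡sum g ⟨
    Σ' g  ∎

  Σ'-zero : ∀ {k} {f : Fin k → Carrier} → (∀ i → f i ≈ 0#) → Σ' f ≈ 0#
  Σ'-zero {k} f≈0 = trans (Σ'-cong f≈0) (trans (reflexive (Σ'≡sum {k} (λ _ → 0#))) (sum-replicate-zero k))

  Σ'-distrib-+ : ∀ {k} (f g : Fin k → Carrier) → Σ' (λ i → f i + g i) ≈ Σ' f + Σ' g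
  Σ'-distrib-+ f g = begin
    Σ' (λ i → f i + g i)   ≡⟨ Σ'≡sum (λ i → f i + g i) ⟩
    sum (λ i → f i + g i)  ≈⟨ ∑-distrib-+ f g ⟩
    sum f + sum g          ≡⟨ ≡.cong₂ _+_ (Σ'≡sum f) (Σ'≡sum g) ⟨
    Σ' f + Σ' g            ∎

  Σ'-comm : ∀ {k m} (f : Fin k → Fin m → Carrier) →
            Σ' (λ i → Σ' (f i)) ≈ Σ' (λ j → Σ' (λ i → f i j))
  Σ'-comm f = begin
    Σ' (λ i → Σ' (f i))           ≡⟨ Σ'≡sum (λ i → Σ' (f i)) ⟩
    sum (λ i → Σ' (f i))          ≡⟨ sum-cong-≗ (λ i → Σ'≡sum (f i)) ⟩
    sum (λ i → sum (f i))         ≈⟨ ∑-comm f ⟩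
    sum (λ j → sum (λ i → f i j)) ≡⟨ sum-cong-≗ (λ j → Σ'≡sum (λ i → f i j)) ⟨
    sum (λ j → Σ' (λ i → f i j))  ≡⟨ Σ'≡sum (λ j → Σ' (λ i → f i j)) ⟨
    Σ' (λ j → Σ' (λ i → f i j))   ∎

  *-distribˡ-Σ' : ∀ {k} x (f : Fin k → Carrier) → x * Σ' f ≈ Σ' (λ i → x * f i)
  *-distribˡ-Σ' x f = begin
    x * Σ' f              ≡⟨ ≡.cong (x *_) (Σ'≡sum f) ⟩
    x * sum f             ≈⟨ *-distribˡ-sum x f ⟩
    sum (λ i → x * f i)   ≡⟨ Σ'≡sum (λ i → x * f i) ⟨
    Σ' (λ i → x * f i)    ∎

  *-distribʳ-Σ' : ∀ {k} x (f : Fin k → Carrier) → Σ' f * x ≈ Σ' (λ i → f i * x)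
  *-distribʳ-Σ' x f = begin
    Σ' f * x              ≡⟨ ≡.cong (_* x) (Σ'≡sum f) ⟩
    sum f * x             ≈⟨ *-distribʳ-sum x f ⟩
    sum (λ i → f i * x)   ≡⟨ Σ'≡sum (λ i → f i * x) ⟨
    Σ' (λ i → f i * x)    ∎

  -‿distrib-Σ' : ∀ {k} (f : Fin k → Carrier) → - Σ' f ≈ Σ' (λ i → - f i)
  -‿distrib-Σ' f = begin
    - Σ' f                 ≈⟨ -1*x≈-x (Σ' f) ⟨
    - 1# * Σ' f            ≈⟨ *-distribˡ-Σ' (- 1#) f ⟩
    Σ' (λ i → - 1# * f i)  ≈⟨ Σ'-cong (λ i → -1*x≈-x (f i)) ⟩
    Σ' (λ i → - f i)       ∎

  I : ∀ {k} → Mat k k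
  I Fin.zero    Fin.zero    = 1#
  I Fin.zero    (Fin.suc _) = 0#
  I (Fin.suc _) Fin.zero    = 0#
  I (Fin.suc i) (Fin.suc j) = I i j

  I-diag : ∀ {k} (i : Fin k) → I i i ≡ 1#
  I-diag Fin.zero    = ≡.refl
  I-diag (Fin.suc i) = I-diag i

  I-sym : ∀ {k} (i j : Fin k) → I i j ≡ I j i
  I-sym Fin.zero    Fin.zero    = ≡.refl
  I-sym Fin.zero    (Fin.suc _) = ≡.refl
  I-sym (Fin.suc _) Fin.zero    = ≡.refl
  I-sym (Fin.suc i) (Fin.suc j) = I-sym i j

  I-off : ∀ {k} (i j : Fin k) → i ≢ j → I i j ≡ 0#
  I-off Fin.zero    Fin.zero    i≢j = contradiction ≡.refl i≢j
  I-off Fin.zero    (Fin.suc _) _   = ≡.refl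
  I-off (Fin.suc _) Fin.zero    _   = ≡.refl
  I-off (Fin.suc i) (Fin.suc j) i≢j = I-off i j (i≢j ∘ ≡.cong Fin.suc)

  I-↑ˡ : ∀ {m n} (a b : Fin m) → I (a ↑ˡ n) (b ↑ˡ n) ≡ I a b
  I-↑ˡ Fin.zero    Fin.zero    = ≡.refl
  I-↑ˡ Fin.zero    (Fin.suc _) = ≡.refl
  I-↑ˡ (Fin.suc _) Fin.zero    = ≡.refl
  I-↑ˡ (Fin.suc a) (Fin.suc b) = I-↑ˡ a b

  I-↑ʳ : ∀ m {n} (a b : Fin n) → I (m ↑ʳ a) (m ↑ʳ b) ≡ I a b
  I-↑ʳ zero    a b = ≡.refl
  I-↑ʳ (suc m) a b = I-↑ʳ m a b

  I-↑ˡ-↑ʳ : ∀ {m n} (a : Fin m) (b : Fin n) → I (a ↑ˡ n) (m ↑ʳ b) ≡ 0#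
  I-↑ˡ-↑ʳ Fin.zero    b = ≡.refl
  I-↑ˡ-↑ʳ (Fin.suc a) b = I-↑ˡ-↑ʳ a b

  I-↑ʳ-↑ˡ : ∀ {m n} (a : Fin n) (b : Fin m) → I (m ↑ʳ a) (b ↑ˡ n) ≡ 0#
  I-↑ʳ-↑ˡ a Fin.zero    = ≡.refl
  I-↑ʳ-↑ˡ a (Fin.suc b) = I-↑ʳ-↑ˡ a b

  Σ'-I : ∀ {k} (i : Fin k) (f : Fin k → Carrier) → Σ' (λ j → I i j * f j) ≈ f i
  Σ'-I Fin.zero f = begin
    1# * f Fin.zero + Σ' (λ j → 0# * f (Fin.suc j))
      ≈⟨ +-cong (*-identityˡ _) (Σ'-zero (λ j → zeroˡ (f (Fin.suc j)))) ⟩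
    f Fin.zero + 0#
      ≈⟨ +-identityʳ _ ⟩
    f Fin.zero ∎
  Σ'-I (Fin.suc i) f = trans (+-cong (zeroˡ _) (Σ'-I i (f ∘ Fin.suc))) (+-identityˡ _)

  scale : ∀ {a b} → Carrier → Mat a b → Mat a b
  scale x A i j = x * A i j

  row : ∀ {b} → (Fin b → Carrier) → Mat 1 b
  row v _ = v

  ≈M-refl : ∀ {a b} {A : Mat a b} → A ≈M A
  ≈M-refl i j = refl

  ≈M-sym : ∀ {a b} {A B : Mat a b} → A ≈M B → B ≈M A
  ≈M-sym A≈B i j = sym (A≈B i j)

  ≈M-trans : ∀ {a b} {A B C : Mat a b} → A ≈M B → B ≈M C → A ≈M C
  ≈M-trans A≈B B≈C i j = trans (A≈B i j) (B≈C i j)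

  ≈M-setoid : ℕ → ℕ → Setoid c ℓ
  ≈M-setoid a b = record
    { Carrier       = Mat a b
    ; _≈_           = _≈M_
    ; isEquivalence = record { refl = ≈M-refl ; sym = ≈M-sym ; trans = ≈M-trans }
    }

  module ≈M-Reasoning {a b : ℕ} = SetoidReasoning (≈M-setoid a b)

  ⊛-cong : ∀ {a b d} {A A′ : Mat a b} {B B′ : Mat b d} →
           A ≈M A′ → B ≈M B′ → (A ⊛ B) ≈M (A′ ⊛ B′)
  ⊛-cong A≈A′ B≈B′ i j = Σ'-cong (λ k → *-cong (A≈A′ i k) (B≈B′ k j))

  ⊛-congˡ : ∀ {a b d} (A : Mat a b) {B B′ : Mat b d} → B ≈M B′ → (A ⊛ B) ≈M (A ⊛ B′)
  ⊛-congˡ A = ⊛-cong (≈M-refl {A = A})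

  ⊛-congʳ : ∀ {a b d} (B : Mat b d) {A A′ : Mat a b} → A ≈M A′ → (A ⊛ B) ≈M (A′ ⊛ B)
  ⊛-congʳ B A≈A′ = ⊛-cong A≈A′ (≈M-refl {A = B})

  transpose-cong : ∀ {a b} {A B : Mat a b} → A ≈M B → transpose A ≈M transpose B
  transpose-cong A≈B i j = A≈B j i

  ⊛-assoc : ∀ {a b d f} (A : Mat a b) (B : Mat b d) (C : Mat d f) → ((A ⊛ B) ⊛ C) ≈M (A ⊛ (B ⊛ C))
  ⊛-assoc {b = b} {d = d} A B C i j = begin
    Σ' (λ k → Σ' (λ l → A i l * B l k) * C k j)
      ≈⟨ Σ'-cong {d} (λ k → *-distribʳ-Σ' (C k j) (λ l → A i l * B l k)) ⟩
    Σ' (λ k → Σ' (λ l → (A i l * B l k) * C k j))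
      ≈⟨ Σ'-comm (λ k l → (A i l * B l k) * C k j) ⟩
    Σ' (λ l → Σ' (λ k → (A i l * B l k) * C k j))
      ≈⟨ Σ'-cong {b} (λ l → Σ'-cong {d} (λ k → *-assoc _ _ _)) ⟩
    Σ' (λ l → Σ' (λ k → A i l * (B l k * C k j)))
      ≈⟨ Σ'-cong {b} (λ l → *-distribˡ-Σ' (A i l) (λ k → B l k * C k j)) ⟨
    Σ' (λ l → A i l * Σ' (λ k → B l k * C k j)) ∎

  ⊛-identityˡ : ∀ {a b} (A : Mat a b) → (I ⊛ A) ≈M A
  ⊛-identityˡ A i j = Σ'-I i (λ k → A k j)

  ⊛-identityʳ : ∀ {a b} (A : Mat a b) → (A ⊛ I) ≈M A
  ⊛-identityʳ {b = b} A i j = begin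
    Σ' (λ k → A i k * I k j) ≈⟨ Σ'-cong {b} (λ k → trans (*-comm _ _) (*-congʳ (reflexive (I-sym k j)))) ⟩
    Σ' (λ k → I j k * A i k) ≈⟨ Σ'-I j (A i) ⟩
    A i j                    ∎

  transpose-⊛ : ∀ {a b d} (A : Mat a b) (B : Mat b d) → transpose (A ⊛ B) ≈M (transpose B ⊛ transpose A)
  transpose-⊛ {b = b} A B i j = Σ'-cong {b} (λ k → *-comm _ _)

  ⊛-scaleˡ : ∀ {a b d} x (A : Mat a b) (B : Mat b d) → (scale x A ⊛ B) ≈M scale x (A ⊛ B)
  ⊛-scaleˡ {b = b} x A B i j = begin
    Σ' (λ k → x * A i k * B k j)   ≈⟨ Σ'-cong {b} (λ k → *-assoc _ _ _) ⟩
    Σ' (λ k → x * (A i k * B k j)) ≈⟨ *-distribˡ-Σ' x (λ k → A i k * B k j) ⟨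
    x * Σ' (λ k → A i k * B k j)   ∎

  ⊛-scaleʳ : ∀ {a b d} x (A : Mat a b) (B : Mat b d) → (A ⊛ scale x B) ≈M scale x (A ⊛ B)
  ⊛-scaleʳ {b = b} x A B i j = begin
    Σ' (λ k → A i k * (x * B k j)) ≈⟨ Σ'-cong {b} (λ k → x∙yz≈y∙xz _ _ _) ⟩
    Σ' (λ k → x * (A i k * B k j)) ≈⟨ *-distribˡ-Σ' x (λ k → A i k * B k j) ⟨
    x * Σ' (λ k → A i k * B k j)   ∎

  ⊛-negʳ : ∀ {a b d} (A : Mat a b) (B : Mat b d) → (A ⊛ negM B) ≈M negM (A ⊛ B)
  ⊛-negʳ {b = b} A B i j = begin
    Σ' (λ k → A i k * - B k j)   ≈⟨ Σ'-cong {b} (λ k → -‿distribʳ-* _ _) ⟨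
    Σ' (λ k → - (A i k * B k j)) ≈⟨ -‿distrib-Σ' (λ k → A i k * B k j) ⟨
    - Σ' (λ k → A i k * B k j)   ∎

  negM-cong : ∀ {a b} {A B : Mat a b} → A ≈M B → negM A ≈M negM B
  negM-cong A≈B i j = -‿cong (A≈B i j)

  scale-congʳ : ∀ {a b} x {A B : Mat a b} → A ≈M B → scale x A ≈M scale x B
  scale-congʳ x A≈B i j = *-congˡ (A≈B i j)

  scale-scale : ∀ {a b} x y (A : Mat a b) → scale x (scale y A) ≈M scale (x * y) A
  scale-scale x y A i j = sym (*-assoc x y (A i j))

  negM-involutive : ∀ {a b} (A : Mat a b) → negM (negM A) ≈M A
  negM-involutive A i j = ⁻¹-involutive (A i j)

  ·-cong : ∀ {a b} {v w : Fin a → Carrier} {A B : Mat a b} →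
           (∀ k → v k ≈ w k) → A ≈M B → ∀ j → (v · A) j ≈ (w · B) j
  ·-cong v≈w A≈B = ⊛-cong {A = row _} (λ _ → v≈w) A≈B Fin.zero

  ·-⊛ : ∀ {a b d} (v : Fin a → Carrier) (A : Mat a b) (B : Mat b d) j →
        ((v · A) · B) j ≈ (v · (A ⊛ B)) j
  ·-⊛ v A B = ⊛-assoc (row v) A B Fin.zero

  ·-identityʳ : ∀ {a} (v : Fin a → Carrier) j → (v · I) j ≈ v j
  ·-identityʳ v = ⊛-identityʳ (row v) Fin.zero

  I-· : ∀ {a b} (i : Fin a) (A : Mat a b) j → (I i · A) j ≈ A i j
  I-· i A = ⊛-identityˡ A i

  ·-linear : ∀ {a b} x y (v w : Fin a → Carrier) (A : Mat a b) j →
             ((λ k → x * v k + y * w k) · A) j ≈ x * (v · A) j + y * (w · A) j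
  ·-linear x y v w A j = begin
    Σ' (λ k → (x * v k + y * w k) * A k j)
      ≈⟨ Σ'-cong (λ k → distribʳ (A k j) (x * v k) (y * w k)) ⟩
    Σ' (λ k → x * v k * A k j + y * w k * A k j)
      ≈⟨ Σ'-distrib-+ (λ k → x * v k * A k j) (λ k → y * w k * A k j) ⟩
    Σ' (λ k → x * v k * A k j) + Σ' (λ k → y * w k * A k j)
      ≈⟨ +-cong (Σ'-cong (λ k → *-assoc x (v k) (A k j))) (Σ'-cong (λ k → *-assoc y (w k) (A k j))) ⟩
    Σ' (λ k → x * (v k * A k j)) + Σ' (λ k → y * (w k * A k j))
      ≈⟨ +-cong (*-distribˡ-Σ' x (λ k → v k * A k j)) (*-distribˡ-Σ' y (λ k → w k * A k j)) ⟨
    x * (v · A) j + y * (w · A) j ∎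

  ·-zeroˡ : ∀ {a b} {v : Fin a → Carrier} (A : Mat a b) → (∀ k → v k ≈ 0#) → ∀ j → (v · A) j ≈ 0#
  ·-zeroˡ A v≈0 j = Σ'-zero (λ k → trans (*-congʳ (v≈0 k)) (zeroˡ (A k j)))

  pair : ∀ {a} → Carrier → Carrier → Fin a → Fin a → Fin a → Carrier
  pair x y i j k = x * I i k + y * I j k

  pair-· : ∀ {a b} x y (i j : Fin a) (A : Mat a b) l → (pair x y i j · A) l ≈ x * A i l + y * A j l
  pair-· x y i j A l = trans (·-linear x y (I i) (I j) A l) (+-cong (*-congˡ (I-· i A l)) (*-congˡ (I-· j A l)))

  pair-left : ∀ {a} x y {i j : Fin a} → i ≢ j → pair x y i j i ≈ x
  pair-left x y {i} {j} i≢j = begin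
    x * I i i + y * I j i  ≡⟨ ≡.cong₂ (λ u w → x * u + y * w) (I-diag i) (I-off j i (i≢j ∘ ≡.sym)) ⟩
    x * 1# + y * 0#        ≈⟨ +-cong (*-identityʳ x) (zeroʳ y) ⟩
    x + 0#                 ≈⟨ +-identityʳ x ⟩
    x                      ∎

  pair-right : ∀ {a} x y {i j : Fin a} → i ≢ j → pair x y i j j ≈ y
  pair-right x y {i} {j} i≢j = begin
    x * I i j + y * I j j  ≡⟨ ≡.cong₂ (λ u w → x * u + y * w) (I-off i j i≢j) (I-diag j) ⟩
    x * 0# + y * 1#        ≈⟨ +-cong (zeroʳ x) (*-identityʳ y) ⟩
    0# + y                 ≈⟨ +-identityˡ y ⟩
    y                      ∎

  module RightInverse {a b} (T : Mat a b) (S : Mat b a) (T⊛S≈I : (T ⊛ S) ≈M I) where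

    ·-·-inverse : ∀ (v : Fin a → Carrier) j → ((v · T) · S) j ≈ v j
    ·-·-inverse v j = trans (·-⊛ v T S j) (trans (·-cong (λ _ → refl) T⊛S≈I j) (·-identityʳ v j))

    ⊛-⊛-inverse : ∀ {m} (A : Mat m a) → ((A ⊛ T) ⊛ S) ≈M A
    ⊛-⊛-inverse A = ≈M-trans (⊛-assoc A T S) (≈M-trans (⊛-congˡ A T⊛S≈I) (⊛-identityʳ A))

    ·-cancelʳ : ∀ {v w} → (∀ j → (v · T) j ≈ (w · T) j) → ∀ j → v j ≈ w j
    ·-cancelʳ {v} {w} vT≈wT j = begin
      v j             ≈⟨ ·-·-inverse v j ⟨
      ((v · T) · S) j ≈⟨ ·-cong vT≈wT (≈M-refl {A = S}) j ⟩
      ((w · T) · S) j ≈⟨ ·-·-inverse w j ⟩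
      w j             ∎

    LinIndep-⊛ : ∀ {m} {A : Mat m a} → LinIndep A → LinIndep (A ⊛ T)
    LinIndep-⊛ {A = A} indep v vAT≈0 = indep v λ j → begin
      (v · A) j              ≈⟨ ·-·-inverse (v · A) j ⟨
      (((v · A) · T) · S) j  ≈⟨ ·-zeroˡ S (λ k → trans (·-⊛ v A T k) (vAT≈0 k)) j ⟩
      0#                     ∎

    multipliers-agree : ∀ {T₁ : Mat a b} {i j x y d} → i ≢ j →
      (∀ l → T₁ i l ≈ x * T i l) → (∀ l → T₁ j l ≈ y * T j l) →
      (∀ l → T₁ i l + T₁ j l ≈ d * (T i l + T j l)) → x ≈ y
    multipliers-agree {T₁} {i} {j} {x} {y} {d} i≢j rowᵢ rowⱼ rowᵢ+rowⱼ = begin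
      x               ≈⟨ pair-left x y i≢j ⟨
      pair x y i j i  ≈⟨ same i ⟩
      pair d d i j i  ≈⟨ pair-left d d i≢j ⟩
      d               ≈⟨ pair-right d d i≢j ⟨
      pair d d i j j  ≈⟨ same j ⟨
      pair x y i j j  ≈⟨ pair-right x y i≢j ⟩
      y               ∎
      where
        same : ∀ k → pair x y i j k ≈ pair d d i j k
        same = ·-cancelʳ λ l → begin
          (pair x y i j · T) l   ≈⟨ pair-· x y i j T l ⟩
          x * T i l + y * T j l  ≈⟨ +-cong (rowᵢ l) (rowⱼ l) ⟨
          T₁ i l + T₁ j l        ≈⟨ rowᵢ+rowⱼ l ⟩
          d * (T i l + T j l)    ≈⟨ distribˡ d (T i l) (T j l) ⟩
          d * T i l + d * T j l  ≈⟨ pair-· d d i j T l ⟨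
          (pair d d i j · T) l   ∎

  proportional-rows⇒proportional : ∀ {a b} {T₁ T₂ : Mat a b} (S : Mat b a) → (T₂ ⊛ S) ≈M I →
    (∀ v → (∃ λ k → ¬ (v k ≈ 0#)) → ∃ λ x → ∀ j → (v · T₁) j ≈ x * (v · T₂) j) →
    ∃ λ x → T₁ ≈M scale x T₂
  proportional-rows⇒proportional {zero}  _ _ _ = 1# , λ ()
  proportional-rows⇒proportional {suc a} {b} {T₁} {T₂} S T₂⊛S≈I proportional =
    proj₁ (multiplier Fin.zero) , rows
    where
      open RightInverse T₂ S T₂⊛S≈I using (multipliers-agree)

      pair-1-1-· : ∀ (A : Mat (suc a) b) i j l → (pair 1# 1# i j · A) l ≈ A i l + A j l
      pair-1-1-· A i j l = trans (pair-· 1# 1# i j A l) (+-cong (*-identityˡ (A i l)) (*-identityˡ (A j l)))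

      multiplier : ∀ i → ∃ λ x → ∀ l → T₁ i l ≈ x * T₂ i l
      multiplier i with x , prop ← proportional (I i) (i , ≈1⇒≉0 (reflexive (I-diag i)))
        = x , λ l → trans (sym (I-· i T₁ l)) (trans (prop l) (*-congˡ (I-· i T₂ l)))

      sum-multiplier : ∀ {i j} → i ≢ j → ∃ λ d → ∀ l → T₁ i l + T₁ j l ≈ d * (T₂ i l + T₂ j l)
      sum-multiplier {i} {j} i≢j
        with d , prop ← proportional (pair 1# 1# i j) (i , ≈1⇒≉0 (pair-left 1# 1# i≢j))
        = d , λ l → trans (sym (pair-1-1-· T₁ i j l)) (trans (prop l) (*-congˡ (pair-1-1-· T₂ i j l)))

      rows : T₁ ≈M scale (proj₁ (multiplier Fin.zero)) T₂
      rows Fin.zero    = proj₂ (multiplier Fin.zero)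
      rows (Fin.suc i) l = trans (proj₂ (multiplier (Fin.suc i)) l) (*-congʳ
        (multipliers-agree {T₁ = T₁} 1+i≢0 (proj₂ (multiplier (Fin.suc i))) (proj₂ (multiplier Fin.zero))
                           (proj₂ (sum-multiplier 1+i≢0))))
        where
          1+i≢0 : Fin.suc i ≢ Fin.zero
          1+i≢0 ()

  δ≈I : ∀ a b → δ a b ≈ I a b
  δ≈I a b with a Fin.≟ b
  ... | yes ≡.refl = reflexive (≡.sym (I-diag a))
  ... | no  a≢b    = reflexive (≡.sym (I-off a b a≢b))

  K-row-top : ∀ a k → K (a ↑ˡ ν) k ≈ I (ν ↑ʳ a) k
  K-row-top a = splitAt-elim ν (λ k → K (a ↑ˡ ν) k ≈ I (ν ↑ʳ a) k) left right
    where
      left : ∀ b → K (a ↑ˡ ν) (b ↑ˡ ν) ≈ I (ν ↑ʳ a) (b ↑ˡ ν)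
      left b rewrite splitAt-↑ˡ ν a ν | splitAt-↑ˡ ν b ν | I-↑ʳ-↑ˡ {ν} a b = refl
      right : ∀ b → K (a ↑ˡ ν) (ν ↑ʳ b) ≈ I (ν ↑ʳ a) (ν ↑ʳ b)
      right b rewrite splitAt-↑ˡ ν a ν | splitAt-↑ʳ ν ν b | I-↑ʳ ν a b = δ≈I a b

  K-row-bottom : ∀ a k → K (ν ↑ʳ a) k ≈ - I (a ↑ˡ ν) k
  K-row-bottom a = splitAt-elim ν (λ k → K (ν ↑ʳ a) k ≈ - I (a ↑ˡ ν) k) left right
    where
      left : ∀ b → K (ν ↑ʳ a) (b ↑ˡ ν) ≈ - I (a ↑ˡ ν) (b ↑ˡ ν)
      left b rewrite splitAt-↑ʳ ν ν a | splitAt-↑ˡ ν b ν | I-↑ˡ {n = ν} a b = -‿cong (δ≈I a b)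
      right : ∀ b → K (ν ↑ʳ a) (ν ↑ʳ b) ≈ - I (a ↑ˡ ν) (ν ↑ʳ b)
      right b rewrite splitAt-↑ʳ ν ν a | splitAt-↑ʳ ν ν b | I-↑ˡ-↑ʳ {ν} a b = sym -0#≈0#

  K-⊛-top : ∀ {d} (B : Mat n d) a j → (K ⊛ B) (a ↑ˡ ν) j ≈ B (ν ↑ʳ a) j
  K-⊛-top B a j = trans (Σ'-cong (λ k → *-congʳ (K-row-top a k))) (Σ'-I (ν ↑ʳ a) (λ k → B k j))

  K-⊛-bottom : ∀ {d} (B : Mat n d) a j → (K ⊛ B) (ν ↑ʳ a) j ≈ - B (a ↑ˡ ν) j
  K-⊛-bottom B a j = begin
    Σ' (λ k → K (ν ↑ʳ a) k * B k j)      ≈⟨ Σ'-cong (λ k → *-congʳ (K-row-bottom a k)) ⟩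
    Σ' (λ k → - I (a ↑ˡ ν) k * B k j)    ≈⟨ Σ'-cong (λ k → -‿distribˡ-* (I (a ↑ˡ ν) k) (B k j)) ⟨
    Σ' (λ k → - (I (a ↑ˡ ν) k * B k j))  ≈⟨ -‿distrib-Σ' (λ k → I (a ↑ˡ ν) k * B k j) ⟨
    - Σ' (λ k → I (a ↑ˡ ν) k * B k j)    ≈⟨ -‿cong (Σ'-I (a ↑ˡ ν) (λ k → B k j)) ⟩
    - B (a ↑ˡ ν) j                       ∎

  K⊛K≈-I : (K ⊛ K) ≈M negM I
  K⊛K≈-I = splitAt-elim ν (λ i → ∀ j → (K ⊛ K) i j ≈ - I i j)
    (λ a j → trans (K-⊛-top K a j) (K-row-bottom a j))
    (λ a j → trans (K-⊛-bottom K a j) (-‿cong (K-row-top a j)))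

  K-↑ˡ-↑ʳ : ∀ a → K (a ↑ˡ ν) (ν ↑ʳ a) ≈ 1#
  K-↑ˡ-↑ʳ a = trans (K-row-top a (ν ↑ʳ a)) (reflexive (I-diag (ν ↑ʳ a)))

module SymplecticMatrices {c ℓ} (F : Field c ℓ) (ν : ℕ) where
  open Field F
  open Spi F ν
  open MatrixAlgebra F ν

  rightInverse⇒leftInverse : ∀ {q k} → Enumeration setoid q → {T S : Mat k k} →
                             (T ⊛ S) ≈M I → (S ⊛ T) ≈M I
  rightInverse⇒leftInverse {k = k} enumeration {T} {S} T⊛S≈I = begin
    S ⊛ T            ≈⟨ ⊛-congʳ T S≈W ⟩
    W ⊛ T            ≈⟨ W⊛T≈I ⟩
    I                ∎
    where
      open RightInverse T S T⊛S≈I using (·-cancelʳ)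
      open ≈M-Reasoning

      ·T-surjective : ∀ u → ∃ λ v → ∀ j → (v · T) j ≈ u j
      ·T-surjective = enumerated-injective⇒surjective (vectorEnumeration enumeration k) (_· T) ·-cancelʳ

      W : Mat k k
      W i = proj₁ (·T-surjective (I i))

      W⊛T≈I : (W ⊛ T) ≈M I
      W⊛T≈I i = proj₂ (·T-surjective (I i))

      S≈W : S ≈M W
      S≈W = begin
        S            ≈⟨ ⊛-identityˡ S ⟨
        I ⊛ S        ≈⟨ ⊛-congʳ S W⊛T≈I ⟨
        (W ⊛ T) ⊛ S  ≈⟨ ⊛-assoc W T S ⟩
        W ⊛ (T ⊛ S)  ≈⟨ ⊛-congˡ W T⊛S≈I ⟩
        W ⊛ I        ≈⟨ ⊛-identityʳ W ⟩
        W            ∎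

  -- K⁻¹ = −K, so T K Tᵗ = K makes −K Tᵗ K a right inverse of T.
  symplecticInverse : Mat n n → Mat n n
  symplecticInverse T = negM (K ⊛ (transpose T ⊛ K))

  symplectic⇒rightInverse : ∀ {T} → IsSymplectic T → (T ⊛ symplecticInverse T) ≈M I
  symplectic⇒rightInverse {T} TKTᵗ≈K = begin
    T ⊛ negM (K ⊛ (transpose T ⊛ K))    ≈⟨ ⊛-negʳ T (K ⊛ (transpose T ⊛ K)) ⟩
    negM (T ⊛ (K ⊛ (transpose T ⊛ K)))  ≈⟨ negM-cong T⊛K⊛Tᵗ⊛K≈-I ⟩
    negM (negM I)                       ≈⟨ negM-involutive I ⟩
    I                                   ∎
    where
      open ≈M-Reasoning
      T⊛K⊛Tᵗ⊛K≈-I : (T ⊛ (K ⊛ (transpose T ⊛ K))) ≈M negM I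
      T⊛K⊛Tᵗ⊛K≈-I = begin
        T ⊛ (K ⊛ (transpose T ⊛ K))   ≈⟨ ⊛-assoc T K (transpose T ⊛ K) ⟨
        (T ⊛ K) ⊛ (transpose T ⊛ K)   ≈⟨ ⊛-assoc (T ⊛ K) (transpose T) K ⟨
        ((T ⊛ K) ⊛ transpose T) ⊛ K   ≈⟨ ⊛-congʳ K TKTᵗ≈K ⟩
        K ⊛ K                         ≈⟨ K⊛K≈-I ⟩
        negM I                        ∎

  symplectic-preserves-form : ∀ {T} → IsSymplectic T → ∀ {m m′} (A : Mat m n) (B : Mat m′ n) →
                              (((A ⊛ T) ⊛ K) ⊛ transpose (B ⊛ T)) ≈M ((A ⊛ K) ⊛ transpose B)
  symplectic-preserves-form {T} TKTᵗ≈K A B = begin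
    ((A ⊛ T) ⊛ K) ⊛ transpose (B ⊛ T)            ≈⟨ ⊛-congˡ ((A ⊛ T) ⊛ K) (transpose-⊛ B T) ⟩
    ((A ⊛ T) ⊛ K) ⊛ (transpose T ⊛ transpose B)  ≈⟨ ⊛-assoc ((A ⊛ T) ⊛ K) (transpose T) (transpose B) ⟨
    (((A ⊛ T) ⊛ K) ⊛ transpose T) ⊛ transpose B
      ≈⟨ ⊛-congʳ (transpose B) (⊛-congʳ (transpose T) (⊛-assoc A T K)) ⟩
    ((A ⊛ (T ⊛ K)) ⊛ transpose T) ⊛ transpose B
      ≈⟨ ⊛-congʳ (transpose B) (⊛-assoc A (T ⊛ K) (transpose T)) ⟩
    (A ⊛ ((T ⊛ K) ⊛ transpose T)) ⊛ transpose B  ≈⟨ ⊛-congʳ (transpose B) (⊛-congˡ A TKTᵗ≈K) ⟩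
    (A ⊛ K) ⊛ transpose B                        ∎
    where open ≈M-Reasoning

  scale-form : ∀ {m} x (T : Mat m n) →
               ((scale x T ⊛ K) ⊛ transpose (scale x T)) ≈M scale (x * x) ((T ⊛ K) ⊛ transpose T)
  scale-form x T = begin
    (scale x T ⊛ K) ⊛ scale x (transpose T)    ≈⟨ ⊛-scaleʳ x (scale x T ⊛ K) (transpose T) ⟩
    scale x ((scale x T ⊛ K) ⊛ transpose T)    ≈⟨ scale-congʳ x (⊛-congʳ (transpose T) (⊛-scaleˡ x T K)) ⟩
    scale x (scale x (T ⊛ K) ⊛ transpose T)    ≈⟨ scale-congʳ x (⊛-scaleˡ x (T ⊛ K) (transpose T)) ⟩
    scale x (scale x ((T ⊛ K) ⊛ transpose T))  ≈⟨ scale-scale x x _ ⟩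
    scale (x * x) ((T ⊛ K) ⊛ transpose T)      ∎
    where open ≈M-Reasoning

  symplectic-multiple⇒x²≈1 : Fin ν → ∀ {x T₁ T₂} → T₁ ≈M scale x T₂ →
                             IsSymplectic T₁ → IsSymplectic T₂ → x * x ≈ 1#
  symplectic-multiple⇒x²≈1 a {x} {T₁} {T₂} T₁≈xT₂ T₁-sp T₂-sp = begin
    x * x              ≈⟨ *-identityʳ (x * x) ⟨
    x * x * 1#         ≈⟨ *-congˡ (K-↑ˡ-↑ʳ a) ⟨
    x * x * K z w      ≈⟨ form z w ⟨
    K z w              ≈⟨ K-↑ˡ-↑ʳ a ⟩
    1#                 ∎
    where
      open SetoidReasoning setoid
      z w : Fin n
      z = a ↑ˡ ν
      w = ν ↑ʳ a
      form : K ≈M scale (x * x) K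
      form = ≈M-trans (≈M-sym T₁-sp) (≈M-trans (⊛-cong (⊛-congʳ K T₁≈xT₂) (transpose-cong T₁≈xT₂))
               (≈M-trans (scale-form x T₂) (scale-congʳ (x * x) T₂-sp)))

module SpiGraph {c ℓ} (F : Field c ℓ) (ν : ℕ) where
  open Field F
  open Spi F ν
  open FieldProperties F
  open MatrixAlgebra F ν
  open SymplecticMatrices F ν
  open import Algebra.Properties.Ring ring using (-1*x≈-x)
  open SetoidReasoning setoid

  InRowSpace-⊛ : ∀ {m} {B : Mat m n} (M : Mat n n) {u} → InRowSpace B u → InRowSpace (B ⊛ M) (u · M)
  InRowSpace-⊛ {B = B} M (v , vB≈u) = v , λ j → trans (sym (·-⊛ v B M j)) (·-cong vB≈u (≈M-refl {A = M}) j)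

  InRowSpace-resp : ∀ {m} {B B′ : Mat m n} {u u′} → B ≈M B′ → (∀ j → u j ≈ u′ j) →
                    InRowSpace B u → InRowSpace B′ u′
  InRowSpace-resp B≈B′ u≈u′ (v , vB≈u) =
    v , λ j → trans (·-cong (λ _ → refl) (≈M-sym B≈B′) j) (trans (vB≈u j) (u≈u′ j))

  InRowSpace-row : ∀ {m} (B : Mat m n) x i → InRowSpace B (λ j → x * B i j)
  InRowSpace-row B x i = (λ k → x * I i k) , λ j → begin
    Σ' (λ k → x * I i k * B k j)    ≈⟨ Σ'-cong (λ k → *-assoc x (I i k) (B k j)) ⟩
    Σ' (λ k → x * (I i k * B k j))  ≈⟨ *-distribˡ-Σ' x (λ k → I i k * B k j) ⟨
    x * (I i · B) j                 ≈⟨ *-congˡ (I-· i B j) ⟩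
    x * B i j                       ∎

  InRowSpace-row-multiple : ∀ {u w : Fin n → Carrier} → InRowSpace (row w) u →
                            ∃ λ x → ∀ j → u j ≈ x * w j
  InRowSpace-row-multiple (v , vw≈u) = v Fin.zero , λ j → trans (sym (vw≈u j)) (+-identityʳ _)

  ≋-resp : ∀ {m m′} {A A′ : Mat m n} {B B′ : Mat m′ n} → A ≈M A′ → B ≈M B′ →
           (m , A) ≋ (m′ , B) → (m , A′) ≋ (m′ , B′)
  ≋-resp A≈A′ B≈B′ (A⊆B , B⊆A) = (λ i → InRowSpace-resp B≈B′ (A≈A′ i) (A⊆B i))
                               , (λ i → InRowSpace-resp A≈A′ (B≈B′ i) (B⊆A i))

  ≋-⊛ : ∀ {m m′} {A : Mat m n} {B : Mat m′ n} (M : Mat n n) →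
        (m , A) ≋ (m′ , B) → (m , A ⊛ M) ≋ (m′ , B ⊛ M)
  ≋-⊛ M (A⊆B , B⊆A) = (λ i → InRowSpace-⊛ M (A⊆B i)) , (λ i → InRowSpace-⊛ M (B⊆A i))

  ≋-refl : ∀ {m} (A : Mat m n) → (m , A) ≋ (m , A)
  ≋-refl A = A⊆A , A⊆A
    where
      A⊆A : ∀ i → InRowSpace A (A i)
      A⊆A i = InRowSpace-resp ≈M-refl (λ j → *-identityˡ (A i j)) (InRowSpace-row A 1# i)

  negM-≋ : ∀ {m} (A : Mat m n) → (m , negM A) ≋ (m , A)
  negM-≋ A = (λ i → InRowSpace-resp ≈M-refl (λ j → -1*x≈-x (A i j)) (InRowSpace-row A (- 1#) i))
           , (λ i → InRowSpace-resp ≈M-refl (λ j → trans (-1*x≈-x _) (negM-involutive A i j))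
                                    (InRowSpace-row (negM A) (- 1#) i))

  σ-isAutomorphism : ∀ {T S} → (T ⊛ S) ≈M I → (S ⊛ T) ≈M I → IsSymplectic T → IsAutomorphism (σ T)
  σ-isAutomorphism {T} {S} T⊛S≈I S⊛T≈I T-sp = record
    { closed     = λ { (m , A) (1≤m , m<n , indep) → 1≤m , m<n , T.LinIndep-⊛ indep }
    ; wellDef    = λ _ _ _ _ → ≋-⊛ T
    ; injective  = λ { (m , A) (m′ , B) _ _ AT≋BT →
                       ≋-resp (T.⊛-⊛-inverse A) (T.⊛-⊛-inverse B) (≋-⊛ S AT≋BT) }
    ; surjective = λ { (m , B) (1≤m , m<n , indep) →
                       (m , B ⊛ S) , (1≤m , m<n , S.LinIndep-⊛ indep)
                     , ≋-resp ≈M-refl (S.⊛-⊛-inverse B) (≋-refl ((B ⊛ S) ⊛ T)) }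
    ; adjTo      = λ { (m , A) (m′ , B) _ _ adj i j → trans (symplectic-preserves-form T-sp A B i j) (adj i j) }
    ; adjFrom    = λ { (m , A) (m′ , B) _ _ adj i j → trans (sym (symplectic-preserves-form T-sp A B i j)) (adj i j) }
    }
    where
      module T = RightInverse T S T⊛S≈I
      module S = RightInverse S T S⊛T≈I

  symplectic⇒σ-isAutomorphism : ∀ {q} → Enumeration setoid q → ∀ {T} → IsSymplectic T → IsAutomorphism (σ T)
  symplectic⇒σ-isAutomorphism enumeration {T} T-sp =
    σ-isAutomorphism T⊛T⁻≈I (rightInverse⇒leftInverse enumeration T⊛T⁻≈I) T-sp
    where
      T⊛T⁻≈I : (T ⊛ symplecticInverse T) ≈M I
      T⊛T⁻≈I = symplectic⇒rightInverse T-sp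

  row-isVertex : 1 < n → ∀ {v : Fin n → Carrier} k → ¬ (v k ≈ 0#) → IsVertex (1 , row v)
  row-isVertex 1<n {v} k vk≉0 = ≤-refl , 1<n , indep
    where
      indep : LinIndep (row v)
      indep u u·v≈0 Fin.zero = nonzero*≈0⇒≈0 vk≉0 (begin
        v k * u Fin.zero  ≈⟨ *-comm (v k) (u Fin.zero) ⟩
        u Fin.zero * v k  ≈⟨ +-identityʳ _ ⟨
        (u · row v) k     ≈⟨ u·v≈0 k ⟩
        0#                ∎)

  σ-agree⇒proportional-rows : 1 < n → ∀ {T₁ T₂} → (∀ A → IsVertex A → σ T₁ A ≋ σ T₂ A) →
    ∀ v → (∃ λ k → ¬ (v k ≈ 0#)) → ∃ λ x → ∀ j → (v · T₁) j ≈ x * (v · T₂) j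
  σ-agree⇒proportional-rows 1<n agree v (k , vk≉0) =
    InRowSpace-row-multiple (proj₁ (agree (1 , row v) (row-isVertex 1<n k vk≉0)) Fin.zero)

  σ-agree⇒≈± : Decidable _≈_ → 1 ≤ ν → ∀ {T₁ T₂} → IsSymplectic T₁ → IsSymplectic T₂ →
               (∀ A → IsVertex A → σ T₁ A ≋ σ T₂ A) → T₁ ≈M T₂ ⊎ T₁ ≈M negM T₂
  σ-agree⇒≈± _≟_ 1≤ν {T₁} {T₂} T₁-sp T₂-sp agree
    with x , T₁≈xT₂ ← proportional-rows⇒proportional (symplecticInverse T₂) (symplectic⇒rightInverse T₂-sp)
                        (σ-agree⇒proportional-rows (+-mono-≤ 1≤ν 1≤ν) agree)
    with x*x≈1⇒x≈±1 _≟_ (symplectic-multiple⇒x²≈1 (Fin.fromℕ< 1≤ν) T₁≈xT₂ T₁-sp T₂-sp)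
  ... | inj₁ x≈1  = inj₁ λ i j → trans (T₁≈xT₂ i j) (trans (*-congʳ x≈1) (*-identityˡ (T₂ i j)))
  ... | inj₂ x≈-1 = inj₂ λ i j → trans (T₁≈xT₂ i j) (trans (*-congʳ x≈-1) (-1*x≈-x (T₂ i j)))

  ≈±⇒σ-agree : ∀ {T₁ T₂} → T₁ ≈M T₂ ⊎ T₁ ≈M negM T₂ → ∀ A → σ T₁ A ≋ σ T₂ A
  ≈±⇒σ-agree {T₁} {T₂} (inj₁ T₁≈T₂)  (m , A) =
    ≋-resp ≈M-refl (⊛-congˡ A T₁≈T₂) (≋-refl (A ⊛ T₁))
  ≈±⇒σ-agree {T₁} {T₂} (inj₂ T₁≈-T₂) (m , A) =
    ≋-resp (≈M-sym (≈M-trans (⊛-congˡ A T₁≈-T₂) (⊛-negʳ A T₂))) ≈M-refl (negM-≋ (A ⊛ T₂))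

proposition3p2 : ∀ {c ℓ} (F : Field c ℓ) (q : ℕ) → IsPrimePower q → HasSize F q →
    (ν : ℕ) → 1 ≤ ν →
    (∀ T → Spi.IsSymplectic F ν T → Spi.IsAutomorphism F ν (Spi.σ F ν T)) ×
    (∀ T₁ T₂ → Spi.IsSymplectic F ν T₁ → Spi.IsSymplectic F ν T₂ →
      ((∀ A → Spi.IsVertex F ν A → Spi._≋_ F ν (Spi.σ F ν T₁ A) (Spi.σ F ν T₂ A)) →
        (Spi._≈M_ F ν T₁ T₂ ⊎ Spi._≈M_ F ν T₁ (Spi.negM F ν T₂))) ×
      ((Spi._≈M_ F ν T₁ T₂ ⊎ Spi._≈M_ F ν T₁ (Spi.negM F ν T₂)) →
        (∀ A → Spi.IsVertex F ν A → Spi._≋_ F ν (Spi.σ F ν T₁ A) (Spi.σ F ν T₂ A))))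
proposition3p2 F q _ size ν 1≤ν =
    (λ T → symplectic⇒σ-isAutomorphism enumeration)
  , (λ T₁ T₂ T₁-sp T₂-sp → σ-agree⇒≈± (enumerated⇒decidable enumeration) 1≤ν T₁-sp T₂-sp
                         , λ T₁≈±T₂ A _ → ≈±⇒σ-agree T₁≈±T₂ A)
  where
    -- only the finiteness of F is used
    open FieldProperties F
    open SpiGraph F ν

    enumeration : Enumeration (Field.setoid F) q
    enumeration = hasSize⇒enumeration size
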